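{- Fix integers $a,b$ and positive integers $n_1,n_2$. Let $X_1,X_2,\dots$ be i.i.d. with $P(X_i=a)=P(X_i=b)=\tfrac12$, $S_0=0$, $S_k=X_1+\dots+X_k$, and for an integer $n$ define $q(n,k)=P(S_j<n \text{ for all } j=0,\dots,k)$ ($k\ge0$) and $r(n,k)=P(S_k\ge n \text{ and } S_j<n \text{ for all } j=0,\dots,k-1)$ ($k\ge1$). For positive integers $m_1,m_2$ let $p_{m_1,m_2}=\sum_{k=1}^{\infty} q(m_1,k)\, r(m_2,k)$. Consider the game in which the first player $A$ and second player $B$ alternately (A first in each round) add $a$ or $b$ chips independently with probability $1/2$ each to their own piles starting at $0$, where $A$ wins if he collects at least $n_1$ chips before $B$ collects at least $n_2$ chips, and $B$ wins if he collects at least $n_2$ chips before $A$ collects at least $n_1$ chips. If the probability that one of the players wins this game is $1$, then \[p_{n_1,n_2}+p_{n_2,n_1}+\sum_{k=1}^{\infty} r(n_1,k)\, r(n_2,k)=1.\]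
   Context: $p_{n_1,n_2}$ is the probability that the second player collects $n_2$ chips before the first player collects $n_1$ chips. -}

module Defs where

open import Data.Bool using (Bool; true; false; _∧_; _∨_; not)
open import Data.Nat as ℕ using (ℕ; zero; suc; _^_)
open import Data.Nat.Properties using (m^n≢0)
open import Data.Integer as ℤ using (ℤ; +_)
import Data.Integer.Properties as ℤP
open import Data.List using (List; []; _∷_; map; concatMap; filter; length; take; upTo; foldr)
open import Data.Bool.ListAction using (all; any)
open import Data.Rational as ℚ using (ℚ; _/_; 0ℚ; 1ℚ)
open import Relation.Nullary.Decidable using (⌊_⌋)

-- All coin-flip sequences of length k (true ↦ step a, false ↦ step b);
-- each of the 2^k sequences has probability (1/2)^k.
paths : ℕ → List (List Bool)
paths zero    = [] ∷ []
paths (suc k) = concatMap (λ xs → (true ∷ xs) ∷ (false ∷ xs) ∷ []) (paths k)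

stepVal : ℤ → ℤ → Bool → ℤ
stepVal a b true  = a
stepVal a b false = b

sumℤ : List ℤ → ℤ
sumℤ = foldr ℤ._+_ (+ 0)

S : ℤ → ℤ → List Bool → ℕ → ℤ
S a b xs j = sumℤ (map (stepVal a b) (take j xs))

_<ᵇ_ : ℤ → ℤ → Bool
x <ᵇ y = ⌊ x ℤ.<? y ⌋

_≥ᵇ_ : ℤ → ℤ → Bool
x ≥ᵇ y = ⌊ y ℤ.≤? x ⌋

count : {A : Set} → (A → Bool) → List A → ℕ
count p xs = length (filter (λ x → Data.Bool.T? (p x)) xs)
  where import Data.Bool

prob : ℕ → (List Bool → Bool) → ℚ
prob k ev = (+ count ev (paths k)) / (2 ^ k)
  where instance _ = m^n≢0 2 k

-- probability of an event depending on the first k steps of two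
-- independent sequences (one per player)
prob₂ : ℕ → (List Bool → List Bool → Bool) → ℚ
prob₂ k ev = (+ countPairs) / (2 ^ (k ℕ.+ k))
  where
  instance _ = m^n≢0 2 (k ℕ.+ k)
  countPairs : ℕ
  countPairs = foldr ℕ._+_ 0 (map (λ xs → count (ev xs) (paths k)) (paths k))

q : ℤ → ℤ → ℤ → ℕ → ℚ
q a b n k = prob k (λ xs → all (λ j → S a b xs j <ᵇ n) (upTo (suc k)))

r : ℤ → ℤ → ℤ → ℕ → ℚ
r a b n k = prob k (λ xs → (S a b xs k ≥ᵇ n) ∧ all (λ j → S a b xs j <ᵇ n) (upTo k))

Σ₁ : ℕ → (ℕ → ℚ) → ℚ
Σ₁ zero    f = 0ℚ
Σ₁ (suc K) f = Σ₁ K f ℚ.+ f (suc K)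

partialTotal : ℤ → ℤ → ℤ → ℤ → ℕ → ℚ
partialTotal a b n₁ n₂ K =
  Σ₁ K (λ k → q a b n₁ k ℚ.* r a b n₂ k)
  ℚ.+ Σ₁ K (λ k → q a b n₂ k ℚ.* r a b n₁ k)
  ℚ.+ Σ₁ K (λ k → r a b n₁ k ℚ.* r a b n₂ k)

-- Game: in round j (j = 1,2,...) A makes his j-th step, then B makes his j-th step.
-- A wins as soon as his pile reaches ≥ n₁, B as soon as his reaches ≥ n₂; the
-- game stops at the first such event.  Hence "one of the players has won
-- within the first K rounds" is the event that some j ∈ {1..K} has
-- S^A_j ≥ n₁ or S^B_j ≥ n₂.
someoneWonBy : ℤ → ℤ → ℤ → ℤ → ℕ → ℚ
someoneWonBy a b n₁ n₂ K =
  prob₂ K (λ xs ys → any (λ j → (S a b xs (suc j) ≥ᵇ n₁) ∨ (S a b ys (suc j) ≥ᵇ n₂)) (upTo K))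

_⟶_ : (ℕ → ℚ) → ℚ → Set
s ⟶ L = ∀ (ε : ℚ) → 0ℚ ℚ.< ε → Σ ℕ λ N → ∀ K → N ℕ.≤ K → ℚ.∣ s K ℚ.- L ∣ ℚ.< ε
  where open import Data.Product using (Σ)

-- The event {S_0, …, S_k < n} splits according to whether S_{k+1} < n, so
-- q(n,k) = q(n,k+1) + r(n,k+1). Substituting this into q(n₁,k) q(n₂,k) makes the product
-- telescope: the K-th partial sum of p_{n₁,n₂} + p_{n₂,n₁} + Σ r(n₁,k) r(n₂,k) is
-- q(n₁,0) q(n₂,0) − q(n₁,K) q(n₂,K) = 1 − q(n₁,K) q(n₂,K). Since the players are independent,
-- q(n₁,K) q(n₂,K) is the probability that neither has reached his target after K rounds, so
-- the partial sum equals the probability that someone has won within K rounds.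

module Submission where

open import Defs
open import Algebra.Properties.CommutativeSemigroup using (interchange)
open import Algebra.Properties.Group using (∙-cancelʳ)
open import Data.Bool using (Bool; true; false; _∧_; _∨_; not; if_then_else_)
open import Data.Bool.Properties using (∧-assoc; ∧-comm; ∧-identityʳ; ∧-zeroʳ)
open import Data.Bool.ListAction using (all; any)
open import Data.List using (List; []; _∷_; [_]; _++_; length; take; upTo; applyUpTo; map; concatMap)
open import Data.List.Properties using (upTo-∷ʳ; take-take)
open import Data.Nat as ℕ using (ℕ; zero; suc; _+_; _*_; _^_; _<_; _≤_; NonZero)
import Data.Nat.Properties as ℕ
open import Data.Nat.ListAction using (sum)
open import Data.Integer as ℤ using (ℤ; +_; +<+)
import Data.Integer.Properties as ℤ
open import Data.Rational as ℚ using (ℚ; _/_; fromℚᵘ; 1ℚ)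
import Data.Rational.Properties as ℚ
open import Data.Rational.Unnormalised as ℚᵘ using (mkℚᵘ; *≡*)
import Data.Rational.Unnormalised.Properties as ℚᵘ
open import Data.Rational.Solver using (module +-*-Solver)
open import Data.Product using (_,_)
open import Function using (_∘_; id)
open import Relation.Nullary using (yes; no; contradiction)
open import Relation.Binary.PropositionalEquality using (_≡_; refl; sym; trans; cong; cong₂; subst; module ≡-Reasoning)

private
  variable A B : Set

  +-interchange : ∀ w x y z → (w + x) + (y + z) ≡ (w + y) + (x + z)
  +-interchange = interchange ℕ.+-commutativeSemigroup

fromℚᵘ-homo-+ : ∀ p q → fromℚᵘ (p ℚᵘ.+ q) ≡ fromℚᵘ p ℚ.+ fromℚᵘ q
fromℚᵘ-homo-+ p q = ℚ.toℚᵘ-injective (ℚᵘ.≃-trans (ℚ.toℚᵘ-fromℚᵘ (p ℚᵘ.+ q))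
  (ℚᵘ.≃-sym (ℚᵘ.≃-trans (ℚ.toℚᵘ-homo-+ (fromℚᵘ p) (fromℚᵘ q))
    (ℚᵘ.+-cong (ℚ.toℚᵘ-fromℚᵘ p) (ℚ.toℚᵘ-fromℚᵘ q)))))

fromℚᵘ-homo-* : ∀ p q → fromℚᵘ (p ℚᵘ.* q) ≡ fromℚᵘ p ℚ.* fromℚᵘ q
fromℚᵘ-homo-* p q = ℚ.toℚᵘ-injective (ℚᵘ.≃-trans (ℚ.toℚᵘ-fromℚᵘ (p ℚᵘ.* q))
  (ℚᵘ.≃-sym (ℚᵘ.≃-trans (ℚ.toℚᵘ-homo-* (fromℚᵘ p) (fromℚᵘ q))
    (ℚᵘ.*-cong (ℚ.toℚᵘ-fromℚᵘ p) (ℚ.toℚᵘ-fromℚᵘ q)))))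

/-cross : ∀ m n d e .{{_ : NonZero d}} .{{_ : NonZero e}} →
          m * e ≡ n * d → (+ m) / d ≡ (+ n) / e
/-cross m n (suc d) (suc e) eq = ℚ.fromℚᵘ-cong {mkℚᵘ (+ m) d} {mkℚᵘ (+ n) e}
  (*≡* (trans (sym (ℤ.pos-* m (suc e))) (trans (cong +_ eq) (ℤ.pos-* n (suc d)))))

+-/ : ∀ m n d e .{{_ : NonZero d}} .{{_ : NonZero e}} →
      (+ m) / d ℚ.+ (+ n) / e ≡ ((+ (m * e + n * d)) / (d * e)) {{ℕ.m*n≢0 d e}}
+-/ m n (suc d) (suc e) = trans (sym (fromℚᵘ-homo-+ (mkℚᵘ (+ m) d) (mkℚᵘ (+ n) e)))
  (ℚ./-cong (sym (trans (ℤ.pos-+ (m * suc e) (n * suc d))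
                        (cong₂ ℤ._+_ (ℤ.pos-* m (suc e)) (ℤ.pos-* n (suc d))))) refl)

*-/ : ∀ m n d e .{{_ : NonZero d}} .{{_ : NonZero e}} →
      ((+ m) / d) ℚ.* ((+ n) / e) ≡ ((+ (m * n)) / (d * e)) {{ℕ.m*n≢0 d e}}
*-/ m n (suc d) (suc e) = trans (sym (fromℚᵘ-homo-* (mkℚᵘ (+ m) d) (mkℚᵘ (+ n) e)))
  (ℚ./-cong (sym (ℤ.pos-* m n)) refl)

+-/-same : ∀ m n d .{{_ : NonZero d}} → (+ m) / d ℚ.+ (+ n) / d ≡ (+ (m + n)) / d
+-/-same m n d = trans (+-/ m n d d) (/-cross (m * d + n * d) (m + n) (d * d) d {{ℕ.m*n≢0 d d}} (begin
  (m * d + n * d) * d  ≡⟨ cong (_* d) (ℕ.*-distribʳ-+ d m n) ⟨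
  (m + n) * d * d      ≡⟨ ℕ.*-assoc (m + n) d d ⟩
  (m + n) * (d * d)    ∎))
  where open ≡-Reasoning

/-scale : ∀ s m d .{{_ : NonZero s}} .{{_ : NonZero d}} →
          ((+ (s * m)) / (s * d)) {{ℕ.m*n≢0 s d}} ≡ (+ m) / d
/-scale s m d = /-cross (s * m) m (s * d) d {{ℕ.m*n≢0 s d}} (begin
  s * m * d    ≡⟨ cong (_* d) (ℕ.*-comm s m) ⟩
  m * s * d    ≡⟨ ℕ.*-assoc m s d ⟩
  m * (s * d)  ∎)
  where open ≡-Reasoning

n/n≡1 : ∀ n .{{_ : NonZero n}} → (+ n) / n ≡ 1ℚ
n/n≡1 n = /-cross n 1 n 1 (trans (ℕ.*-identityʳ n) (sym (ℕ.+-identityʳ n)))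

all-++ : ∀ (p : A → Bool) xs ys → all p (xs ++ ys) ≡ all p xs ∧ all p ys
all-++ p []       ys = refl
all-++ p (x ∷ xs) ys = trans (cong (p x ∧_) (all-++ p xs ys)) (sym (∧-assoc (p x) _ _))

all-upTo-suc : ∀ (p : ℕ → Bool) m → all p (upTo (suc m)) ≡ all p (upTo m) ∧ p m
all-upTo-suc p m = begin
  all p (upTo (suc m))           ≡⟨ cong (all p) (upTo-∷ʳ m) ⟨
  all p (upTo m ++ [ m ])        ≡⟨ all-++ p (upTo m) [ m ] ⟩
  all p (upTo m) ∧ (p m ∧ true)  ≡⟨ cong (all p (upTo m) ∧_) (∧-identityʳ (p m)) ⟩
  all p (upTo m) ∧ p m           ∎
  where open ≡-Reasoning

all-upTo-cong : ∀ {p p′ : ℕ → Bool} m → (∀ j → j < m → p j ≡ p′ j) →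
                all p (upTo m) ≡ all p′ (upTo m)
all-upTo-cong zero    eq = refl
all-upTo-cong {p} {p′} (suc m) eq = begin
  all p (upTo (suc m))    ≡⟨ all-upTo-suc p m ⟩
  all p (upTo m) ∧ p m    ≡⟨ cong₂ _∧_ (all-upTo-cong m (λ j j<m → eq j (ℕ.m<n⇒m<1+n j<m))) (eq m ℕ.≤-refl) ⟩
  all p′ (upTo m) ∧ p′ m  ≡⟨ all-upTo-suc p′ m ⟨
  all p′ (upTo (suc m))   ∎
  where open ≡-Reasoning

all-applyUpTo-∘ : ∀ (p : ℕ → Bool) (f g : ℕ → ℕ) m →
                  all p (applyUpTo (f ∘ g) m) ≡ all (p ∘ f) (applyUpTo g m)
all-applyUpTo-∘ p f g zero    = refl
all-applyUpTo-∘ p f g (suc m) = cong (p (f (g 0)) ∧_) (all-applyUpTo-∘ p f (g ∘ suc) m)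

any-cong : ∀ {p p′ : A → Bool} xs → (∀ x → p x ≡ p′ x) → any p xs ≡ any p′ xs
any-cong []       eq = refl
any-cong (x ∷ xs) eq = cong₂ _∨_ (eq x) (any-cong xs eq)

any-not-∨-not : ∀ (p q : A → Bool) xs →
                any (λ x → not (p x) ∨ not (q x)) xs ≡ not (all p xs ∧ all q xs)
any-not-∨-not p q []       = refl
any-not-∨-not p q (x ∷ xs) with p x | q x
... | true  | true  = any-not-∨-not p q xs
... | true  | false = cong not (sym (∧-zeroʳ (all p xs)))
... | false | _     = refl

count-cong : ∀ {p p′ : A → Bool} xs → (∀ x → p x ≡ p′ x) → count p xs ≡ count p′ xs
count-cong []       eq = refl
count-cong {p = p} {p′} (x ∷ xs) eq with p x | p′ x | eq x
... | true  | _ | refl = cong suc (count-cong xs eq)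
... | false | _ | refl = count-cong xs eq

count-true : ∀ (xs : List A) → count (λ _ → true) xs ≡ length xs
count-true []       = refl
count-true (x ∷ xs) = cong suc (count-true xs)

count-false : ∀ (xs : List A) → count (λ _ → false) xs ≡ 0
count-false []       = refl
count-false (x ∷ xs) = count-false xs

count-split : ∀ (d c : A → Bool) xs →
              count (λ x → d x ∧ c x) xs + count (λ x → d x ∧ not (c x)) xs ≡ count d xs
count-split d c []       = refl
count-split d c (x ∷ xs) with d x | c x
... | false | _     = count-split d c xs
... | true  | true  = cong suc (count-split d c xs)
... | true  | false = trans (ℕ.+-suc _ _) (cong suc (count-split d c xs))

count-complement : ∀ (p : A → Bool) xs → count p xs + count (not ∘ p) xs ≡ length xs
count-complement p xs = trans (count-split (λ _ → true) p xs) (count-true xs)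

count-∷ : ∀ (p : A → Bool) x xs → count p (x ∷ xs) ≡ (if p x then 1 else 0) + count p xs
count-∷ p x xs with p x
... | true  = refl
... | false = refl

count-paths-suc : ∀ (p : List Bool → Bool) k →
  count p (paths (suc k)) ≡ count (p ∘ (true ∷_)) (paths k) + count (p ∘ (false ∷_)) (paths k)
count-paths-suc p k = go (paths k)
  where
  open ≡-Reasoning
  go : ∀ L → count p (concatMap (λ xs → (true ∷ xs) ∷ (false ∷ xs) ∷ []) L)
           ≡ count (p ∘ (true ∷_)) L + count (p ∘ (false ∷_)) L
  go []       = refl
  go (xs ∷ L) = begin
    count p ((true ∷ xs) ∷ (false ∷ xs) ∷ rest)  ≡⟨ count-∷ p _ _ ⟩
    t + count p ((false ∷ xs) ∷ rest)            ≡⟨ cong (λ n → t + n) (count-∷ p _ _) ⟩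
    t + (f + count p rest)                        ≡⟨ cong (λ n → t + (f + n)) (go L) ⟩
    t + (f + (T + F))                             ≡⟨ ℕ.+-assoc t f _ ⟨
    (t + f) + (T + F)                             ≡⟨ +-interchange t f T F ⟩
    (t + T) + (f + F)                             ≡⟨ cong₂ _+_ (count-∷ (p ∘ (true ∷_)) xs L)
                                                               (count-∷ (p ∘ (false ∷_)) xs L) ⟨
    count (p ∘ (true ∷_)) (xs ∷ L) + count (p ∘ (false ∷_)) (xs ∷ L) ∎
    where
    rest = concatMap (λ xs → (true ∷ xs) ∷ (false ∷ xs) ∷ []) L
    t = if p (true ∷ xs) then 1 else 0
    f = if p (false ∷ xs) then 1 else 0
    T = count (p ∘ (true ∷_)) L
    F = count (p ∘ (false ∷_)) L

DeterminedByFirst : ℕ → (List Bool → Bool) → Set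
DeterminedByFirst k p = ∀ xs → p xs ≡ p (take k xs)

count-paths-horizon : ∀ k (p : List Bool → Bool) → DeterminedByFirst k p →
                      count p (paths (suc k)) ≡ 2 * count p (paths k)
count-paths-horizon zero p det
  rewrite count-cong (paths 1) det | count-cong (paths 0) det with p []
... | true  = refl
... | false = refl
count-paths-horizon (suc k) p det = begin
  count p (paths (suc (suc k)))                        ≡⟨ count-paths-suc p (suc k) ⟩
  count p₁ (paths (suc k)) + count p₀ (paths (suc k))  ≡⟨ cong₂ _+_ (count-paths-horizon k p₁ (det ∘ (true ∷_)))
                                                                   (count-paths-horizon k p₀ (det ∘ (false ∷_))) ⟩
  2 * count p₁ (paths k) + 2 * count p₀ (paths k)     ≡⟨ ℕ.*-distribˡ-+ 2 (count p₁ (paths k)) (count p₀ (paths k)) ⟨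
  2 * (count p₁ (paths k) + count p₀ (paths k))       ≡⟨ cong (2 *_) (count-paths-suc p k) ⟨
  2 * count p (paths (suc k))                         ∎
  where
  open ≡-Reasoning
  p₁ p₀ : List Bool → Bool
  p₁ = p ∘ (true ∷_)
  p₀ = p ∘ (false ∷_)

length-paths : ∀ k → length (paths k) ≡ 2 ^ k
length-paths zero    = refl
length-paths (suc k) = begin
  length (paths (suc k))                 ≡⟨ count-true (paths (suc k)) ⟨
  count (λ _ → true) (paths (suc k))     ≡⟨ count-paths-horizon k (λ _ → true) (λ _ → refl) ⟩
  2 * count (λ _ → true) (paths k)       ≡⟨ cong (2 *_) (trans (count-true (paths k)) (length-paths k)) ⟩
  2 * 2 ^ k                              ∎
  where open ≡-Reasoning

countPairs : (A → B → Bool) → List A → List B → ℕ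
countPairs e xs ys = sum (map (λ x → count (e x) ys) xs)

countPairs-cong : ∀ {e e′ : A → B → Bool} xs ys → (∀ x y → e x y ≡ e′ x y) →
                  countPairs e xs ys ≡ countPairs e′ xs ys
countPairs-cong []       ys eq = refl
countPairs-cong (x ∷ xs) ys eq = cong₂ _+_ (count-cong ys (eq x)) (countPairs-cong xs ys eq)

countPairs-complement : ∀ (e : A → B → Bool) xs ys →
  countPairs e xs ys + countPairs (λ x y → not (e x y)) xs ys ≡ length xs * length ys
countPairs-complement e []       ys = refl
countPairs-complement e (x ∷ xs) ys = begin
  (count (e x) ys + E) + (count (not ∘ e x) ys + E′)  ≡⟨ +-interchange (count (e x) ys) E _ E′ ⟩
  (count (e x) ys + count (not ∘ e x) ys) + (E + E′)  ≡⟨ cong₂ _+_ (count-complement (e x) ys) (countPairs-complement e xs ys) ⟩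
  length ys + length xs * length ys                    ∎
  where
  open ≡-Reasoning
  E E′ : ℕ
  E  = countPairs e xs ys
  E′ = countPairs (λ x y → not (e x y)) xs ys

countPairs-product : ∀ (p : A → Bool) (p′ : B → Bool) xs ys →
  countPairs (λ x y → p x ∧ p′ y) xs ys ≡ count p xs * count p′ ys
countPairs-product p p′ []       ys = refl
countPairs-product p p′ (x ∷ xs) ys with p x
... | true  = cong (λ n → count p′ ys + n) (countPairs-product p p′ xs ys)
... | false = trans (cong₂ _+_ (count-false ys) refl) (countPairs-product p p′ xs ys)

module _ (k : ℕ) where
  private instance
    2^k≢0 = ℕ.m^n≢0 2 k
    2^1+k≢0 = ℕ.m^n≢0 2 (suc k)
    2^2k≢0 = ℕ.m^n≢0 2 (k + k)

  prob-cong : ∀ {p p′ : List Bool → Bool} → (∀ xs → p xs ≡ p′ xs) → prob k p ≡ prob k p′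
  prob-cong eq = cong (λ c → (+ c) / 2 ^ k) (count-cong (paths k) eq)

  prob₂-cong : ∀ {e e′ : List Bool → List Bool → Bool} → (∀ xs ys → e xs ys ≡ e′ xs ys) →
               prob₂ k e ≡ prob₂ k e′
  prob₂-cong eq = cong (λ c → (+ c) / 2 ^ (k + k)) (countPairs-cong (paths k) (paths k) eq)

  prob-split : ∀ (d c : List Bool → Bool) →
               prob k (λ xs → d xs ∧ c xs) ℚ.+ prob k (λ xs → d xs ∧ not (c xs)) ≡ prob k d
  prob-split d c = trans (+-/-same (count (λ xs → d xs ∧ c xs) (paths k))
                                   (count (λ xs → d xs ∧ not (c xs)) (paths k)) (2 ^ k))
                         (cong (λ n → (+ n) / 2 ^ k) (count-split d c (paths k)))

  prob-horizon : ∀ (p : List Bool → Bool) → DeterminedByFirst k p → prob (suc k) p ≡ prob k p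
  prob-horizon p det =
    trans (cong (λ n → (+ n) / 2 ^ suc k) (count-paths-horizon k p det))
          (/-scale 2 (count p (paths k)) (2 ^ k))

  prob₂-complement : ∀ (e : List Bool → List Bool → Bool) →
                     prob₂ k e ℚ.+ prob₂ k (λ xs ys → not (e xs ys)) ≡ 1ℚ
  prob₂-complement e = begin
    prob₂ k e ℚ.+ prob₂ k (λ xs ys → not (e xs ys))
      ≡⟨ +-/-same E E′ (2 ^ (k + k)) ⟩
    (+ (E + E′)) / 2 ^ (k + k)
      ≡⟨ cong (λ n → (+ n) / 2 ^ (k + k)) (countPairs-complement e (paths k) (paths k)) ⟩
    (+ (length (paths k) * length (paths k))) / 2 ^ (k + k)
      ≡⟨ cong (λ n → (+ n) / 2 ^ (k + k)) (cong₂ _*_ (length-paths k) (length-paths k)) ⟩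
    (+ (2 ^ k * 2 ^ k)) / 2 ^ (k + k)
      ≡⟨ cong (λ n → (+ n) / 2 ^ (k + k)) (ℕ.^-distribˡ-+-* 2 k k) ⟨
    (+ 2 ^ (k + k)) / 2 ^ (k + k)
      ≡⟨ n/n≡1 (2 ^ (k + k)) ⟩
    1ℚ ∎
    where
    open ≡-Reasoning
    E E′ : ℕ
    E  = countPairs e (paths k) (paths k)
    E′ = countPairs (λ xs ys → not (e xs ys)) (paths k) (paths k)

  prob₂-product : ∀ (p p′ : List Bool → Bool) →
                  prob₂ k (λ xs ys → p xs ∧ p′ ys) ≡ prob k p ℚ.* prob k p′
  prob₂-product p p′ = begin
    prob₂ k (λ xs ys → p xs ∧ p′ ys)
      ≡⟨ cong (λ n → (+ n) / 2 ^ (k + k)) (countPairs-product p p′ (paths k) (paths k)) ⟩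
    (+ (P * P′)) / 2 ^ (k + k)
      ≡⟨ ℚ./-cong {+ (P * P′)} {2 ^ (k + k)} {+ (P * P′)} {2 ^ k * 2 ^ k} {{2^2k≢0}} {{2^k*2^k≢0}}
                  refl (ℕ.^-distribˡ-+-* 2 k k) ⟩
    ((+ (P * P′)) / (2 ^ k * 2 ^ k)) {{2^k*2^k≢0}}
      ≡⟨ *-/ P P′ (2 ^ k) (2 ^ k) ⟨
    prob k p ℚ.* prob k p′ ∎
    where
    open ≡-Reasoning
    P P′ : ℕ
    P  = count p (paths k)
    P′ = count p′ (paths k)
    2^k*2^k≢0 : NonZero (2 ^ k * 2 ^ k)
    2^k*2^k≢0 = ℕ.m*n≢0 (2 ^ k) (2 ^ k)

telescope : ∀ (Q₁ Q₂ R₁ R₂ : ℕ → ℚ) →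
  (∀ k → Q₁ k ≡ Q₁ (suc k) ℚ.+ R₁ (suc k)) → (∀ k → Q₂ k ≡ Q₂ (suc k) ℚ.+ R₂ (suc k)) → ∀ K →
  Σ₁ K (λ k → Q₁ k ℚ.* R₂ k) ℚ.+ Σ₁ K (λ k → Q₂ k ℚ.* R₁ k) ℚ.+ Σ₁ K (λ k → R₁ k ℚ.* R₂ k)
    ℚ.+ Q₁ K ℚ.* Q₂ K ≡ Q₁ 0 ℚ.* Q₂ 0
telescope Q₁ Q₂ R₁ R₂ step₁ step₂ zero    = ℚ.+-identityˡ (Q₁ 0 ℚ.* Q₂ 0)
telescope Q₁ Q₂ R₁ R₂ step₁ step₂ (suc K) = begin
  partial (suc K) ℚ.+ Q₁ (suc K) ℚ.* Q₂ (suc K)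
    ≡⟨ solve 7 (λ s₁ s₂ s₃ q₁ q₂ r₁ r₂ →
                  (s₁ :+ q₁ :* r₂) :+ (s₂ :+ q₂ :* r₁) :+ (s₃ :+ r₁ :* r₂) :+ q₁ :* q₂
                  := s₁ :+ s₂ :+ s₃ :+ (q₁ :+ r₁) :* (q₂ :+ r₂)) refl
         (Σ₁ K (λ k → Q₁ k ℚ.* R₂ k)) (Σ₁ K (λ k → Q₂ k ℚ.* R₁ k)) (Σ₁ K (λ k → R₁ k ℚ.* R₂ k))
         (Q₁ (suc K)) (Q₂ (suc K)) (R₁ (suc K)) (R₂ (suc K)) ⟩
  partial K ℚ.+ (Q₁ (suc K) ℚ.+ R₁ (suc K)) ℚ.* (Q₂ (suc K) ℚ.+ R₂ (suc K))
    ≡⟨ cong (partial K ℚ.+_) (cong₂ ℚ._*_ (step₁ K) (step₂ K)) ⟨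
  partial K ℚ.+ Q₁ K ℚ.* Q₂ K
    ≡⟨ telescope Q₁ Q₂ R₁ R₂ step₁ step₂ K ⟩
  Q₁ 0 ℚ.* Q₂ 0 ∎
  where
  open ≡-Reasoning
  open +-*-Solver
  partial : ℕ → ℚ
  partial K = Σ₁ K (λ k → Q₁ k ℚ.* R₂ k) ℚ.+ Σ₁ K (λ k → Q₂ k ℚ.* R₁ k) ℚ.+ Σ₁ K (λ k → R₁ k ℚ.* R₂ k)

⟶-cong : ∀ {s t : ℕ → ℚ} {L} → (∀ K → s K ≡ t K) → s ⟶ L → t ⟶ L
⟶-cong {L = L} s≡t s⟶L ε ε>0 with s⟶L ε ε>0
... | N , close = N , λ K N≤K → subst (λ x → ℚ.∣ x ℚ.- L ∣ ℚ.< ε) (s≡t K) (close K N≤K)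

≥ᵇ≡not<ᵇ : ∀ x y → (x ≥ᵇ y) ≡ not (x <ᵇ y)
≥ᵇ≡not<ᵇ x y with x ℤ.<? y | y ℤ.≤? x
... | yes x<y | yes y≤x = contradiction y≤x (ℤ.<⇒≱ x<y)
... | yes _   | no _    = refl
... | no _    | yes _   = refl
... | no x≮y  | no y≰x  = contradiction (ℤ.≮⇒≥ x≮y) y≰x

<ᵇ-true : ∀ {x y} → x ℤ.< y → (x <ᵇ y) ≡ true
<ᵇ-true {x} {y} x<y with x ℤ.<? y
... | yes _   = refl
... | no x≮y = contradiction x<y x≮y

module _ (a b : ℤ) where

  staysBelow : ℤ → ℕ → List Bool → Bool
  staysBelow n k xs = all (λ j → S a b xs j <ᵇ n) (upTo (suc k))

  S-take : ∀ {j k} xs → j ≤ k → S a b (take k xs) j ≡ S a b xs j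
  S-take {j} {k} xs j≤k =
    cong (sumℤ ∘ map (stepVal a b)) (trans (take-take j k xs) (cong (λ i → take i xs) (ℕ.m≤n⇒m⊓n≡m j≤k)))

  staysBelow-determined : ∀ n k → DeterminedByFirst k (staysBelow n k)
  staysBelow-determined n k xs =
    all-upTo-cong (suc k) (λ j j<1+k → cong (_<ᵇ n) (sym (S-take xs (ℕ.m<1+n⇒m≤n j<1+k))))

  staysBelow-suc : ∀ n k xs → staysBelow n (suc k) xs ≡ staysBelow n k xs ∧ (S a b xs (suc k) <ᵇ n)
  staysBelow-suc n k xs = all-upTo-suc (λ j → S a b xs j <ᵇ n) (suc k)

  q-step : ∀ n k → q a b n k ≡ q a b n (suc k) ℚ.+ r a b n (suc k)
  q-step n k = begin
    q a b n k
      ≡⟨ prob-horizon k (staysBelow n k) (staysBelow-determined n k) ⟨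
    prob (suc k) (staysBelow n k)
      ≡⟨ prob-split (suc k) (staysBelow n k) stillBelow ⟨
    prob (suc k) (λ xs → staysBelow n k xs ∧ stillBelow xs)
      ℚ.+ prob (suc k) (λ xs → staysBelow n k xs ∧ not (stillBelow xs))
      ≡⟨ cong₂ ℚ._+_ (prob-cong (suc k) (λ xs → sym (staysBelow-suc n k xs)))
                     (prob-cong (suc k) firstCrossing) ⟩
    q a b n (suc k) ℚ.+ r a b n (suc k) ∎
    where
    open ≡-Reasoning
    stillBelow : List Bool → Bool
    stillBelow xs = S a b xs (suc k) <ᵇ n
    firstCrossing : ∀ xs → staysBelow n k xs ∧ not (stillBelow xs)
                         ≡ (S a b xs (suc k) ≥ᵇ n) ∧ staysBelow n k xs
    firstCrossing xs = trans (∧-comm (staysBelow n k xs) _)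
                             (cong (_∧ staysBelow n k xs) (sym (≥ᵇ≡not<ᵇ _ n)))

  q-zero : ∀ {n} → + 0 ℤ.< n → q a b n 0 ≡ 1ℚ
  q-zero 0<n = prob-cong 0 (λ _ → cong (_∧ true) (<ᵇ-true 0<n))

  staysBelow-from-one : ∀ {n} K xs → + 0 ℤ.< n →
                        staysBelow n K xs ≡ all (λ j → S a b xs (suc j) <ᵇ n) (upTo K)
  staysBelow-from-one {n} K xs 0<n = begin
    (S a b xs 0 <ᵇ n) ∧ all below (applyUpTo suc K)  ≡⟨ cong (_∧ all below (applyUpTo suc K)) (<ᵇ-true 0<n) ⟩
    all below (applyUpTo suc K)                      ≡⟨ all-applyUpTo-∘ below suc id K ⟩
    all (below ∘ suc) (upTo K)                       ∎
    where
    open ≡-Reasoning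
    below : ℕ → Bool
    below j = S a b xs j <ᵇ n

  someoneWon≡not-bothBelow : ∀ {n₁ n₂} K xs ys → + 0 ℤ.< n₁ → + 0 ℤ.< n₂ →
    any (λ j → (S a b xs (suc j) ≥ᵇ n₁) ∨ (S a b ys (suc j) ≥ᵇ n₂)) (upTo K)
      ≡ not (staysBelow n₁ K xs ∧ staysBelow n₂ K ys)
  someoneWon≡not-bothBelow {n₁} {n₂} K xs ys 0<n₁ 0<n₂ = begin
    any (λ j → (S a b xs (suc j) ≥ᵇ n₁) ∨ (S a b ys (suc j) ≥ᵇ n₂)) (upTo K)
      ≡⟨ any-cong (upTo K) (λ j → cong₂ _∨_ (≥ᵇ≡not<ᵇ _ n₁) (≥ᵇ≡not<ᵇ _ n₂)) ⟩
    any (λ j → not (below₁ j) ∨ not (below₂ j)) (upTo K)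
      ≡⟨ any-not-∨-not below₁ below₂ (upTo K) ⟩
    not (all below₁ (upTo K) ∧ all below₂ (upTo K))
      ≡⟨ cong not (cong₂ _∧_ (staysBelow-from-one K xs 0<n₁) (staysBelow-from-one K ys 0<n₂)) ⟨
    not (staysBelow n₁ K xs ∧ staysBelow n₂ K ys) ∎
    where
    open ≡-Reasoning
    below₁ below₂ : ℕ → Bool
    below₁ j = S a b xs (suc j) <ᵇ n₁
    below₂ j = S a b ys (suc j) <ᵇ n₂

  someoneWonBy-complement : ∀ {n₁ n₂} K → + 0 ℤ.< n₁ → + 0 ℤ.< n₂ →
    someoneWonBy a b n₁ n₂ K ℚ.+ q a b n₁ K ℚ.* q a b n₂ K ≡ 1ℚ
  someoneWonBy-complement {n₁} {n₂} K 0<n₁ 0<n₂ = begin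
    someoneWonBy a b n₁ n₂ K ℚ.+ q a b n₁ K ℚ.* q a b n₂ K
      ≡⟨ cong₂ ℚ._+_ (prob₂-cong K (λ xs ys → someoneWon≡not-bothBelow K xs ys 0<n₁ 0<n₂))
                     (sym (prob₂-product K (staysBelow n₁ K) (staysBelow n₂ K))) ⟩
    prob₂ K (λ xs ys → not (bothBelow xs ys)) ℚ.+ prob₂ K bothBelow
      ≡⟨ ℚ.+-comm (prob₂ K (λ xs ys → not (bothBelow xs ys))) (prob₂ K bothBelow) ⟩
    prob₂ K bothBelow ℚ.+ prob₂ K (λ xs ys → not (bothBelow xs ys))
      ≡⟨ prob₂-complement K bothBelow ⟩
    1ℚ ∎
    where
    open ≡-Reasoning
    bothBelow : List Bool → List Bool → Bool
    bothBelow xs ys = staysBelow n₁ K xs ∧ staysBelow n₂ K ys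

  partialTotal-complement : ∀ {n₁ n₂} K → + 0 ℤ.< n₁ → + 0 ℤ.< n₂ →
    partialTotal a b n₁ n₂ K ℚ.+ q a b n₁ K ℚ.* q a b n₂ K ≡ 1ℚ
  partialTotal-complement {n₁} {n₂} K 0<n₁ 0<n₂ = trans
    (telescope (q a b n₁) (q a b n₂) (r a b n₁) (r a b n₂) (q-step n₁) (q-step n₂) K)
    (cong₂ ℚ._*_ (q-zero 0<n₁) (q-zero 0<n₂))

  partialTotal≡someoneWonBy : ∀ {n₁ n₂} K → + 0 ℤ.< n₁ → + 0 ℤ.< n₂ →
    partialTotal a b n₁ n₂ K ≡ someoneWonBy a b n₁ n₂ K
  partialTotal≡someoneWonBy {n₁} {n₂} K 0<n₁ 0<n₂ =
    ∙-cancelʳ ℚ.+-0-group (q a b n₁ K ℚ.* q a b n₂ K) _ _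
      (trans (partialTotal-complement K 0<n₁ 0<n₂) (sym (someoneWonBy-complement K 0<n₁ 0<n₂)))

proposition7 : (a b : ℤ) (n₁ n₂ : ℕ) →
    (λ K → someoneWonBy a b (+ suc n₁) (+ suc n₂) K) ⟶ 1ℚ →
    (λ K → partialTotal a b (+ suc n₁) (+ suc n₂) K) ⟶ 1ℚ
proposition7 a b n₁ n₂ =
  ⟶-cong {L = 1ℚ} (λ K → sym (partialTotal≡someoneWonBy a b K (+<+ ℕ.z<s) (+<+ ℕ.z<s)))
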